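{- Let $n,k$ be integers with $2\le k\le n-1$ and let $\mathbf a=a_1a_2\cdots a_n$ be a vertex of $G(n)$. Suppose one of the following holds: (a) for some integer $t\ge 2$ with $n\ge tk+1$, we have $n-(t-2)\in\{a_{k+1},a_{k+2},\dots,a_{n-(t-1)k}\}$, and $j\notin\{a_1,\dots,a_k\}$ for each $j\in\{n-t+3,n-t+4,\dots,n\}$; (b) for some integer $t\ge 2$ with $n\ge tk+1$, we have $t-1\in\{a_{k+1},a_{k+2},\dots,a_{n-(t-1)k}\}$, and $j\notin\{a_1,\dots,a_k\}$ for each $j\in\{1,2,\dots,t-2\}$; (c) for some integer $t\ge 2$ with $n\ge tk+1$, we have $n-(t-1)\in\{a_1,a_2,\dots,a_s\}$ where $s=\min\{k,n-tk\}$, and $j\notin\{a_1,\dots,a_k\}$ for each $j\in\{n-t+2,n-t+3,\dots,n\}$; (d) for some integer $t\ge 2$ with $n\ge tk+1$, we have $t\in\{a_1,a_2,\dots,a_s\}$ where $s=\min\{k,n-tk\}$, and $j\notin\{a_1,\dots,a_k\}$ for each $j\in\{1,2,\dots,t-1\}$. Then $\mathbf a$ is not contained in any closed $k$-walk in $G(n)$.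
   Context: For a sequence of distinct integers $c_1\cdots c_t$, $\mathrm{st}(c_1\cdots c_t)$ is the unique permutation $d_1\cdots d_t$ of $\{1,\dots,t\}$ with $d_i<d_j$ iff $c_i<c_j$. $G(n)$ is the directed multigraph whose vertices are the permutations of $\{1,\dots,n\}$ (one-line notation) and whose edges are the permutations $c_1\cdots c_{n+1}$ of $\{1,\dots,n+1\}$, the edge $c_1\cdots c_{n+1}$ going from $\mathrm{st}(c_1\cdots c_n)$ to $\mathrm{st}(c_2\cdots c_{n+1})$; so there is an edge from $x_1\cdots x_n$ to $w_1\cdots w_n$ iff $\mathrm{st}(x_2\cdots x_n)=\mathrm{st}(w_1\cdots w_{n-1})$. A closed $k$-walk $(v_1,\dots,v_k)$ is a sequence of vertices with an edge from $v_i$ to $v_{i+1}$ for $i<k$ and from $v_k$ to $v_1$; a vertex is contained in it if it is one of the $v_i$. -}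

module Defs where

open import Data.Nat using (ℕ; zero; suc; _+_; _*_; _∸_; _≤_; _<_; _⊓_)
open import Data.Nat.Properties using (_<?_)
open import Data.List using (List; []; _∷_; map; upTo; take; drop; length; filter)
open import Data.List.Membership.Propositional using (_∈_)
open import Data.List.Relation.Binary.Permutation.Propositional using (_↭_)
open import Data.Product using (Σ; _×_; ∃)
open import Relation.Binary.PropositionalEquality using (_≡_)
open import Relation.Nullary using (¬_)

oneTo : ℕ → List ℕ
oneTo n = map suc (upTo n)

IsPerm : ℕ → List ℕ → Set
IsPerm n a = a ↭ oneTo n

st : List ℕ → List ℕ
st c = map (λ x → suc (length (filter (_<? x) c))) c

Edge : ℕ → List ℕ → List ℕ → Set
Edge n x w = Σ (List ℕ) λ c → IsPerm (suc n) c × st (take n c) ≡ x × st (drop 1 c) ≡ w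

-- a closed k-walk (v_0, ..., v_{k-1}) in G(n) (0-indexed here)
ClosedWalk : ℕ → ℕ → (ℕ → List ℕ) → Set
ClosedWalk n k v =
  (∀ i → i < k → IsPerm n (v i)) ×
  (∀ i → suc i < k → Edge n (v i) (v (suc i))) ×
  Edge n (v (k ∸ 1)) (v 0)

OnClosedWalk : ℕ → ℕ → List ℕ → Set
OnClosedWalk n k a = Σ (ℕ → List ℕ) λ v → ClosedWalk n k v × ∃ λ i → i < k × v i ≡ a

-- {a_{i+1}, ..., a_j} (1-based), as a list
slice : ℕ → ℕ → List ℕ → List ℕ
slice i j a = take (j ∸ i) (drop i a)

CondA : ℕ → ℕ → List ℕ → Set
CondA n k a = ∃ λ t → 2 ≤ t × t * k + 1 ≤ n ×
  (n + 2 ∸ t) ∈ slice k (n ∸ (t ∸ 1) * k) a ×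
  (∀ j → n + 3 ≤ j + t → j ≤ n → ¬ (j ∈ take k a))

CondB : ℕ → ℕ → List ℕ → Set
CondB n k a = ∃ λ t → 2 ≤ t × t * k + 1 ≤ n ×
  (t ∸ 1) ∈ slice k (n ∸ (t ∸ 1) * k) a ×
  (∀ j → 1 ≤ j → j + 2 ≤ t → ¬ (j ∈ take k a))

CondC : ℕ → ℕ → List ℕ → Set
CondC n k a = ∃ λ t → 2 ≤ t × t * k + 1 ≤ n ×
  (n + 1 ∸ t) ∈ take (k ⊓ (n ∸ t * k)) a ×
  (∀ j → n + 2 ≤ j + t → j ≤ n → ¬ (j ∈ take k a))

CondD : ℕ → ℕ → List ℕ → Set
CondD n k a = ∃ λ t → 2 ≤ t × t * k + 1 ≤ n ×
  t ∈ take (k ⊓ (n ∸ t * k)) a ×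
  (∀ j → 1 ≤ j → j < t → ¬ (j ∈ take k a))

-- A closed k-walk through a forces st(a_{k+1} ⋯ a_n) = st(a_1 ⋯ a_{n−k}): entries k apart compare
-- like the entries k places earlier.  Each of (a)–(d) yields a value r at a position p with
-- p + rk ≤ n, such that a_1, …, a_k are all ≥ r and p > k or r ≥ 2; for (a) and (c) this holds after
-- replacing every value v by n + 1 − v, which preserves the pattern condition.  If a_{p+k} < a_p,
-- then a_p > a_{p+k} > ⋯ > a_{p+rk} are r + 1 positive values ≤ r.  The value 1 cannot sit at a
-- position q with both q − k and q + k in range, since a_{q−k} > a_q would give a_q > a_{q+k}; this
-- settles r = 1.  If r ≥ 2 and a_{p+k} > a_p, the value 1 lies in the last k positions, while
-- the values 1, …, r − 1 lie after position k and are below a_{p+k}, so k places earlier they sit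
-- at positions carrying values below a_p = r.  Together with the position of 1 these are r distinct
-- positions holding values in {1, …, r − 1}.
module Submission where

open import Defs
open import Data.Empty using (⊥; ⊥-elim)
open import Data.Fin using (toℕ; fromℕ<)
open import Data.Fin.Properties using (pigeonhole; toℕ<n; toℕ-fromℕ<)
open import Data.List using (List; []; _∷_; map; upTo; take; drop; length; filter)
open import Data.List.Properties using (length-map; length-upTo; length-take; filter-accept; filter-reject)
open import Data.List.Membership.Propositional using (_∈_)
open import Data.List.Membership.Propositional.Properties using (∈-map⁺; ∈-map⁻; ∈-upTo⁺; ∈-upTo⁻)
open import Data.List.Relation.Unary.All as All using ()
open import Data.List.Relation.Unary.Any using (here; there)
open import Data.List.Relation.Unary.AllPairs using (_∷_)
open import Data.List.Relation.Unary.Unique.Propositional using (Unique)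
open import Data.List.Relation.Unary.Unique.Propositional.Properties using (upTo⁺; map⁺)
open import Data.List.Relation.Binary.Permutation.Propositional using (↭-sym; ↭⇒↭ₛ)
open import Data.List.Relation.Binary.Permutation.Propositional.Properties using (↭-length; ∈-resp-↭)
open import Data.Nat using (ℕ; zero; suc; _+_; _*_; _∸_; _≤_; _<_; _⊓_; z≤n; s≤s; _≟_; >-nonZero)
open import Data.Nat.Properties
open import Data.Product using (∃; ∃₂; _×_; _,_; proj₁; proj₂; uncurry)
open import Data.Sum using (_⊎_; inj₁; inj₂; [_,_])
open import Function using (_∘_)
open import Relation.Binary.Definitions using (tri<; tri≈; tri>)
open import Relation.Binary.PropositionalEquality hiding ([_])
open import Relation.Nullary using (¬_; yes; no; contradiction)
open import Data.List.Relation.Binary.Permutation.Setoid.Properties (setoid ℕ) using (Unique-resp-↭)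

InjectiveOn : ℕ → (ℕ → ℕ) → Set
InjectiveOn n g = ∀ {i j} → i < n → j < n → g i ≡ g j → i ≡ j

pigeonhole-ℕ : ∀ {m n} → m < n → (g : ℕ → ℕ) → (∀ {i} → i < n → g i < m) → ¬ InjectiveOn n g
pigeonhole-ℕ m<n g g<m g-inj
  with i , j , i<j , eq ← pigeonhole m<n (λ i → fromℕ< (g<m (toℕ<n i))) =
  <⇒≢ i<j (g-inj (toℕ<n i) (toℕ<n j) g-eq)
  where
  g-eq : g (toℕ i) ≡ g (toℕ j)
  g-eq = trans (sym (toℕ-fromℕ< _)) (trans (cong toℕ eq) (toℕ-fromℕ< _))

descending-chain-bound : (g : ℕ → ℕ) (m : ℕ) → (∀ {i} → i < m → g (suc i) < g i) → g m + m ≤ g 0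
descending-chain-bound g zero    _    = ≤-reflexive (+-identityʳ (g 0))
descending-chain-bound g (suc m) desc = begin
  g (suc m) + suc m    ≡⟨ +-suc (g (suc m)) m ⟩
  suc (g (suc m) + m)  ≤⟨ +-monoˡ-≤ m (desc (n<1+n m)) ⟩
  g m + m              ≤⟨ descending-chain-bound g m (desc ∘ m<n⇒m<1+n) ⟩
  g 0                  ∎
  where open ≤-Reasoning

m<n∸o⇒o+m<n : ∀ {m n o} → m < n ∸ o → o + m < n
m<n∸o⇒o+m<n {o = zero}              m<n   = m<n
m<n∸o⇒o+m<n {n = suc n} {o = suc o} m<n∸o = s≤s (m<n∸o⇒o+m<n {n = n} {o} m<n∸o)

-- Positions are 0-based, so the paper's a_i is entry a (i − 1); out of range the entry is 0.
entry : List ℕ → ℕ → ℕ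
entry []       _       = 0
entry (x ∷ _)  zero    = x
entry (_ ∷ xs) (suc i) = entry xs i

entry-∈ : ∀ xs {i} → i < length xs → entry xs i ∈ xs
entry-∈ (x ∷ xs) {zero}  _         = here refl
entry-∈ (x ∷ xs) {suc i} (s≤s i<n) = there (entry-∈ xs i<n)

∈⇒entry : ∀ {x} xs → x ∈ xs → ∃ λ i → i < length xs × entry xs i ≡ x
∈⇒entry (_ ∷ _)  (here refl) = 0 , s≤s z≤n , refl
∈⇒entry (_ ∷ xs) (there x∈)
  with i , i<n , eq ← ∈⇒entry xs x∈ = suc i , s≤s i<n , eq

entry-map : ∀ (f : ℕ → ℕ) xs {i} → i < length xs → entry (map f xs) i ≡ f (entry xs i)
entry-map f (x ∷ xs) {zero}  _         = refl
entry-map f (x ∷ xs) {suc i} (s≤s i<n) = entry-map f xs i<n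

entry-take : ∀ m xs {i} → i < m → entry (take m xs) i ≡ entry xs i
entry-take (suc m) []       _         = refl
entry-take (suc m) (x ∷ xs) {zero}  _ = refl
entry-take (suc m) (x ∷ xs) {suc i} (s≤s i<m) = entry-take m xs i<m

entry-drop : ∀ m xs i → entry (drop m xs) i ≡ entry xs (m + i)
entry-drop zero    xs       i = refl
entry-drop (suc m) []       i = refl
entry-drop (suc m) (x ∷ xs) i = entry-drop m xs i

entry-injective : ∀ xs → Unique xs → InjectiveOn (length xs) (entry xs)
entry-injective (x ∷ xs) (x∉ ∷ u) {zero}  {zero}  _ _ _ = refl
entry-injective (x ∷ xs) (x∉ ∷ u) {zero}  {suc j} _ (s≤s j<n) eq =
  contradiction eq (All.lookup x∉ (entry-∈ xs j<n))
entry-injective (x ∷ xs) (x∉ ∷ u) {suc i} {zero}  (s≤s i<n) _ eq =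
  contradiction (sym eq) (All.lookup x∉ (entry-∈ xs i<n))
entry-injective (x ∷ xs) (x∉ ∷ u) {suc i} {suc j} (s≤s i<n) (s≤s j<n) eq =
  cong suc (entry-injective xs u i<n j<n eq)

entry-∈-take : ∀ xs {m i} → i < m → i < length xs → entry xs i ∈ take m xs
entry-∈-take xs {m} i<m i<n = subst (_∈ take m xs) (entry-take m xs i<m)
  (entry-∈ (take m xs) (subst (_ <_) (sym (length-take m xs)) (⊓-glb i<m i<n)))

∈-slice⇒entry : ∀ {x i j} xs → x ∈ slice i j xs → ∃ λ p → i ≤ p × p < j × entry xs p ≡ x
∈-slice⇒entry {x} {i} {j} xs x∈
  with m , m<len , eq ← ∈⇒entry (take (j ∸ i) (drop i xs)) x∈ =
  i + m , m≤m+n i m , m<n∸o⇒o+m<n m<j∸i , entry-eq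
  where
  m<j∸i : m < j ∸ i
  m<j∸i = <-≤-trans m<len (≤-trans (≤-reflexive (length-take (j ∸ i) (drop i xs))) (m⊓n≤m _ _))
  entry-eq : entry xs (i + m) ≡ x
  entry-eq = trans (sym (entry-drop i xs m)) (trans (sym (entry-take (j ∸ i) (drop i xs) m<j∸i)) eq)

indexOf : ℕ → List ℕ → ℕ
indexOf v []       = 0
indexOf v (x ∷ xs) with x ≟ v
... | yes _ = 0
... | no  _ = suc (indexOf v xs)

indexOf-entry : ∀ {v} xs → v ∈ xs → indexOf v xs < length xs × entry xs (indexOf v xs) ≡ v
indexOf-entry {v} (x ∷ xs) v∈ with x ≟ v
... | yes x≡v = s≤s z≤n , x≡v
indexOf-entry (x ∷ xs) (here v≡x)  | no x≢v = contradiction (sym v≡x) x≢v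
indexOf-entry (x ∷ xs) (there v∈) | no _
  with i<n , eq ← indexOf-entry xs v∈ = s≤s i<n , eq

rank : ℕ → List ℕ → ℕ
rank z xs = length (filter (_<? z) xs)

rank-∷-< : ∀ {x z} xs → x < z → rank z (x ∷ xs) ≡ suc (rank z xs)
rank-∷-< {x} {z} xs x<z = cong length (filter-accept (_<? z) {x} {xs} x<z)

rank-∷-≮ : ∀ {x z} xs → ¬ x < z → rank z (x ∷ xs) ≡ rank z xs
rank-∷-≮ {x} {z} xs x≮z = cong length (filter-reject (_<? z) {x} {xs} x≮z)

rank-mono-≤ : ∀ {y z} → y ≤ z → ∀ xs → rank y xs ≤ rank z xs
rank-mono-≤ y≤z [] = z≤n
rank-mono-≤ {y} {z} y≤z (x ∷ xs) with x <? y | x <? z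
... | yes x<y | yes x<z rewrite rank-∷-< xs x<y | rank-∷-< xs x<z = s≤s (rank-mono-≤ y≤z xs)
... | yes x<y | no  x≮z = contradiction (<-≤-trans x<y y≤z) x≮z
... | no  x≮y | yes x<z rewrite rank-∷-≮ xs x≮y | rank-∷-< xs x<z = m≤n⇒m≤1+n (rank-mono-≤ y≤z xs)
... | no  x≮y | no  x≮z rewrite rank-∷-≮ xs x≮y | rank-∷-≮ xs x≮z = rank-mono-≤ y≤z xs

rank-mono-< : ∀ {y z xs} → y < z → y ∈ xs → rank y xs < rank z xs
rank-mono-< {y} {z} {y ∷ xs} y<z (here refl)
  rewrite rank-∷-≮ xs (<-irrefl {y} refl) | rank-∷-< xs y<z = s≤s (rank-mono-≤ (<⇒≤ y<z) xs)
rank-mono-< {y} {z} {x ∷ xs} y<z (there y∈) with x <? y | x <? z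
... | yes x<y | yes x<z rewrite rank-∷-< xs x<y | rank-∷-< xs x<z = s≤s (rank-mono-< y<z y∈)
... | yes x<y | no  x≮z = contradiction (<-trans x<y y<z) x≮z
... | no  x≮y | yes x<z rewrite rank-∷-≮ xs x≮y | rank-∷-< xs x<z = m<n⇒m<1+n (rank-mono-< y<z y∈)
... | no  x≮y | no  x≮z rewrite rank-∷-≮ xs x≮y | rank-∷-≮ xs x≮z = rank-mono-< y<z y∈

rank-cancel-< : ∀ {y z} xs → rank y xs < rank z xs → y < z
rank-cancel-< {y} {z} xs r< with y <? z
... | yes y<z = y<z
... | no  y≮z = contradiction (rank-mono-≤ (≮⇒≥ y≮z) xs) (<⇒≱ r<)

entry-st : ∀ xs {i} → i < length xs → entry (st xs) i ≡ suc (rank (entry xs i) xs)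
entry-st xs = entry-map (λ x → suc (rank x xs)) xs

st-cancel-< : ∀ xs {i j} → i < length xs → j < length xs →
              entry (st xs) i < entry (st xs) j → entry xs i < entry xs j
st-cancel-< xs i<n j<n lt = rank-cancel-< xs (≤-pred (subst₂ _<_ (entry-st xs i<n) (entry-st xs j<n) lt))

st-mono-< : ∀ xs {i j} → i < length xs → j < length xs →
            entry xs i < entry xs j → entry (st xs) i < entry (st xs) j
st-mono-< xs i<n j<n lt =
  subst₂ _<_ (sym (entry-st xs i<n)) (sym (entry-st xs j<n)) (s≤s (rank-mono-< lt (entry-∈ xs i<n)))

∈-oneTo⁻ : ∀ {n x} → x ∈ oneTo n → 1 ≤ x × x ≤ n
∈-oneTo⁻ x∈ with _ , y∈ , refl ← ∈-map⁻ suc x∈ = s≤s z≤n , ∈-upTo⁻ y∈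

∈-oneTo⁺ : ∀ {n x} → 1 ≤ x → x ≤ n → x ∈ oneTo n
∈-oneTo⁺ {x = suc x} _ x≤n = ∈-map⁺ suc (∈-upTo⁺ x≤n)

IsPerm-length : ∀ {n a} → IsPerm n a → length a ≡ n
IsPerm-length {n} a↭ = trans (↭-length a↭) (trans (length-map suc (upTo n)) (length-upTo n))

IsPerm-unique : ∀ {n a} → IsPerm n a → Unique a
IsPerm-unique {n} a↭ = Unique-resp-↭ (↭⇒↭ₛ (↭-sym a↭)) (map⁺ suc-injective (upTo⁺ n))

record Perm (n : ℕ) : Set where
  field
    value           : ℕ → ℕ
    position        : ℕ → ℕ
    value-range     : ∀ {x} → x < n → 1 ≤ value x × value x ≤ n
    value-injective : InjectiveOn n value
    position-value  : ∀ {v} → 1 ≤ v → v ≤ n → position v < n × value (position v) ≡ v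

fromList : ∀ {n a} → IsPerm n a → Perm n
fromList {n} {a} a↭ = record
  { value           = entry a
  ; position        = λ v → indexOf v a
  ; value-range     = λ x<n → ∈-oneTo⁻ (∈-resp-↭ a↭ (entry-∈ a (<-length x<n)))
  ; value-injective = λ i<n j<n → entry-injective a (IsPerm-unique a↭) (<-length i<n) (<-length j<n)
  ; position-value  = λ 1≤v v≤n →
      let i<len , eq = indexOf-entry a (∈-resp-↭ (↭-sym a↭) (∈-oneTo⁺ 1≤v v≤n))
      in subst (_ <_) (IsPerm-length a↭) i<len , eq
  }
  where
  <-length : ∀ {x} → x < n → x < length a
  <-length = subst (_ <_) (sym (IsPerm-length a↭))

complement : ∀ {n} → Perm n → Perm n
complement {n} P = record
  { value           = λ x → suc n ∸ value x
  ; position        = λ v → position (suc n ∸ v)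
  ; value-range     = λ x<n → complement-range (value-range x<n)
  ; value-injective = λ i<n j<n eq →
      value-injective i<n j<n (∸-cancelˡ-≡ (≤-up (value-range i<n)) (≤-up (value-range j<n)) eq)
  ; position-value  = λ 1≤v v≤n →
      let pos<n , eq = uncurry position-value (complement-range (1≤v , v≤n))
      in pos<n , trans (cong (suc n ∸_) eq) (m∸[m∸n]≡n (m≤n⇒m≤1+n v≤n))
  }
  where
  open Perm P
  ≤-up : ∀ {v} → 1 ≤ v × v ≤ n → v ≤ suc n
  ≤-up (_ , v≤n) = m≤n⇒m≤1+n v≤n
  complement-range : ∀ {v} → 1 ≤ v × v ≤ n → 1 ≤ suc n ∸ v × suc n ∸ v ≤ n
  complement-range (1≤v , v≤n) = m<n⇒0<n∸m (s≤s v≤n) , ∸-monoʳ-≤ (suc n) 1≤v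

-- Half of st(X_{d+1} ⋯ X_n) = st(Y_1 ⋯ Y_{n−d}); for a permutation the other half follows by
-- injectivity (shift-mono-< below).
record ShiftOrder (n d : ℕ) (X Y : ℕ → ℕ) : Set where
  constructor shiftOrder
  field
    reflects : ∀ {x y} → d + x < n → d + y < n → X (d + x) < X (d + y) → Y x < Y y

shiftOrder-refl : ∀ {n X} → ShiftOrder n 0 X X
shiftOrder-refl = shiftOrder λ _ _ lt → lt

shiftOrder-trans : ∀ {n d e X Y Z} → ShiftOrder n d X Y → ShiftOrder n e Y Z → ShiftOrder n (d + e) X Z
shiftOrder-trans {n} {d} {e} {X} (shiftOrder XY) (shiftOrder YZ) = shiftOrder λ {x} {y} dex<n dey<n lt →
  YZ (drop-d dex<n) (drop-d dey<n)
     (XY (regroup x dex<n) (regroup y dey<n) (subst₂ (λ u w → X u < X w) (+-assoc d e x) (+-assoc d e y) lt))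
  where
  regroup : ∀ z → d + e + z < n → d + (e + z) < n
  regroup z = subst (_< n) (+-assoc d e z)
  drop-d : ∀ {z} → d + e + z < n → e + z < n
  drop-d {z} lt = ≤-<-trans (m≤n+m (e + z) d) (regroup z lt)

shiftOrder-complement : ∀ {n d X Y} N → (∀ {z} → z < n → Y z ≤ N) →
                        ShiftOrder n d X Y → ShiftOrder n d (λ z → N ∸ X z) (λ z → N ∸ Y z)
shiftOrder-complement {d = d} N Y≤N (shiftOrder XY) = shiftOrder λ {x} dx<n dy<n lt →
  ∸-monoʳ-< (XY dy<n dx<n (∸-cancelʳ-< lt)) (Y≤N (≤-<-trans (m≤n+m x d) dx<n))

complement-shiftOrder : ∀ {n k} (P : Perm n) → ShiftOrder n k (Perm.value P) (Perm.value P) →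
                        ShiftOrder n k (Perm.value (complement P)) (Perm.value (complement P))
complement-shiftOrder {n} P = shiftOrder-complement (suc n) (m≤n⇒m≤1+n ∘ proj₂ ∘ Perm.value-range P)

edge⇒shiftOrder : ∀ {n x w} → Edge n x w → ShiftOrder n 1 (entry x) (entry w)
edge⇒shiftOrder ([] , c↭ , _) = contradiction (IsPerm-length c↭) λ ()
edge⇒shiftOrder {n} (c ∷ cs , c↭ , refl , refl) = shiftOrder λ 1+i<n 1+j<n lt →
  st-mono-< cs (<-cs 1+i<n) (<-cs 1+j<n)
    (subst₂ _<_ (entry-take n (c ∷ cs) 1+i<n) (entry-take n (c ∷ cs) 1+j<n)
      (st-cancel-< front (<-front 1+i<n) (<-front 1+j<n) lt))
  where
  front = take n (c ∷ cs)
  <-front : ∀ {z} → z < n → z < length front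
  <-front = subst (_ <_) (sym (trans (length-take n (c ∷ cs))
                                     (trans (cong (n ⊓_) (IsPerm-length c↭)) (m≤n⇒m⊓n≡m (n≤1+n n)))))
  <-cs : ∀ {z} → suc z < n → z < length cs
  <-cs = subst (_ <_) (sym (suc-injective (IsPerm-length c↭))) ∘ <-trans (n<1+n _)

module _ {n k} {v : ℕ → List ℕ} (edges : ∀ i → suc i < k → Edge n (v i) (v (suc i))) where

  path⇒shiftOrder : ∀ d i → d + i < k → ShiftOrder n d (entry (v i)) (entry (v (d + i)))
  path⇒shiftOrder zero    i _      = shiftOrder-refl
  path⇒shiftOrder (suc d) i 1+d+i<k =
    subst (λ j → ShiftOrder n (suc d) (entry (v i)) (entry (v j))) (+-suc d i)
      (shiftOrder-trans (edge⇒shiftOrder (edges i (≤-<-trans (s≤s (m≤n+m i d)) 1+d+i<k)))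
                        (path⇒shiftOrder d (suc i) (subst (_< k) (sym (+-suc d i)) 1+d+i<k)))

closedWalk⇒shiftOrder : ∀ {n k v} → ClosedWalk n k v → ∀ {i} → i < k → ShiftOrder n k (entry (v i)) (entry (v i))
closedWalk⇒shiftOrder {n} {suc K} {v} (_ , edges , last) {i} i<k =
  subst (λ d → ShiftOrder n d (entry (v i)) (entry (v i))) around-length
    (shiftOrder-trans to-last around)
  where
  i≤K = ≤-pred i<k
  to-last : ShiftOrder n (K ∸ i) (entry (v i)) (entry (v K))
  to-last = subst (λ j → ShiftOrder n (K ∸ i) (entry (v i)) (entry (v j))) (m∸n+n≡m i≤K)
              (path⇒shiftOrder edges (K ∸ i) i (subst (_< suc K) (sym (m∸n+n≡m i≤K)) (n<1+n K)))
  from-first : ShiftOrder n i (entry (v 0)) (entry (v i))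
  from-first = subst (λ j → ShiftOrder n i (entry (v 0)) (entry (v j))) (+-identityʳ i)
                 (path⇒shiftOrder edges i 0 (subst (_< suc K) (sym (+-identityʳ i)) i<k))
  around : ShiftOrder n (1 + i) (entry (v K)) (entry (v i))
  around = shiftOrder-trans (edge⇒shiftOrder last) from-first
  around-length : K ∸ i + (1 + i) ≡ suc K
  around-length = trans (+-suc (K ∸ i) i) (cong suc (m∸n+n≡m i≤K))

PrefixAtLeast : ∀ {n} → Perm n → ℕ → ℕ → Set
PrefixAtLeast P k r = ∀ {x} → x < k → r ≤ Perm.value P x

Trapped : ∀ {n} → Perm n → ℕ → Set
Trapped {n} P k = ∃₂ λ p r → Perm.value P p ≡ r × r * k + p < n × (k ≤ p ⊎ 2 ≤ r) × PrefixAtLeast P k r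

module ShiftInvariant {n k} (P : Perm n) (1≤k : 1 ≤ k) (shift : ShiftOrder n k (Perm.value P) (Perm.value P)) where
  open Perm P
  open ShiftOrder shift

  shift-<n : ∀ {x} → k + x < n → x < n
  shift-<n {x} = ≤-<-trans (m≤n+m x k)

  shifted-≢ : ∀ x → k + x ≢ x
  shifted-≢ x = ≢-sym (<⇒≢ (m<n+m x 1≤k))

  shift-mono-< : ∀ {x y} → k + x < n → k + y < n → value x < value y → value (k + x) < value (k + y)
  shift-mono-< {x} {y} kx<n ky<n lt with <-cmp (value (k + x)) (value (k + y))
  ... | tri< shifted _ _ = shifted
  ... | tri≈ _ eq _ = contradiction (cong value (+-cancelˡ-≡ k x y (value-injective kx<n ky<n eq))) (<⇒≢ lt)
  ... | tri> _ _ gt = contradiction (reflects ky<n kx<n gt) (<⇒≯ lt)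

  descent : ∀ {p} → value p * k + p < n → value (k + p) < value p → ⊥
  descent {p} bound fall = <-irrefl refl (≤-trans (+-monoˡ-≤ (value p) last-positive) chain)
    where
    term : ℕ → ℕ
    term i = value (i * k + p)
    next : ∀ i → suc i * k + p ≡ k + (i * k + p)
    next i = +-assoc k (i * k) p
    falls : ∀ i → suc i * k + p < n → term (suc i) < term i
    falls zero    _ = subst (λ z → value z < value p) (sym (next 0)) fall
    falls (suc i) b = subst₂ (λ u w → value u < value w) (sym (next (suc i))) (sym (next i))
      (shift-mono-< (subst (_< n) (next (suc i)) b) (subst (_< n) (next i) b′) (falls i b′))
      where
      b′ = ≤-<-trans (+-monoˡ-≤ p (*-monoˡ-≤ k (n≤1+n (suc i)))) b
    chain : term (value p) + value p ≤ value p
    chain = descending-chain-bound term (value p)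
              λ {i} i<v → falls i (≤-<-trans (+-monoˡ-≤ p (*-monoˡ-≤ k i<v)) bound)
    last-positive : 1 ≤ term (value p)
    last-positive = proj₁ (value-range bound)

  minimum-not-interior : ∀ {q} → value q ≡ 1 → k ≤ q → k + q < n → ⊥
  minimum-not-interior {q} q↦1 k≤q kq<n =
    <⇒≱ (subst (value (k + q) <_) (trans (cong value kx≡q) q↦1) climb) (proj₁ (value-range kq<n))
    where
    x = q ∸ k
    kx≡q : k + x ≡ q
    kx≡q = m+[n∸m]≡n k≤q
    kx<n : k + x < n
    kx<n = subst (_< n) (sym kx≡q) (shift-<n kq<n)
    x↦>1 : value q < value x
    x↦>1 = subst (_< value x) (sym q↦1) (≤∧≢⇒< (proj₁ (value-range (shift-<n kx<n)))
             λ 1≡vx → shifted-≢ x (trans kx≡q (value-injective (shift-<n kq<n) (shift-<n kx<n) (trans q↦1 1≡vx))))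
    climb : value (k + q) < value (k + x)
    climb = shift-mono-< kq<n kx<n x↦>1

  few-values-below : ∀ {r} → 1 ≤ r → (h : ℕ → ℕ) → (∀ {i} → i < r → h i < n) →
                     (∀ {i} → i < r → value (h i) < r) → ¬ InjectiveOn r h
  few-values-below {r} 1≤r h h<n h↦<r h-inj =
    pigeonhole-ℕ (∸-monoʳ-< (s≤s z≤n) 1≤r) (λ i → value (h i) ∸ 1)
      (λ i<r → ∸-monoˡ-< (h↦<r i<r) (positive i<r))
      (λ i<r j<r eq → h-inj i<r j<r
        (value-injective (h<n i<r) (h<n j<r) (∸-cancelʳ-≡ (positive i<r) (positive j<r) eq)))
    where
    positive : ∀ {i} → i < r → 1 ≤ value (h i)
    positive = proj₁ ∘ value-range ∘ h<n

  shift-back-below : ∀ {p z} → k + p < n → value p < value (k + p) →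
                     k ≤ z → z < n → value z ≤ value p → value (z ∸ k) < value p
  shift-back-below {p} kp<n rise k≤z z<n z≤p =
    reflects (subst (_< n) (sym kz) z<n) kp<n (subst (λ w → value w < value (k + p)) (sym kz) (≤-<-trans z≤p rise))
    where
    kz = m+[n∸m]≡n k≤z

  module Rise {p} (2≤t : 2 ≤ value p) (kp<n : k + p < n) (prefix : PrefixAtLeast P k (value p))
              (rise : value p < value (k + p)) where

    small : ∀ {u} → suc u < value p → position (suc u) < n × value (position (suc u)) ≡ suc u
    small u<t = position-value (s≤s z≤n) (≤-trans (<⇒≤ u<t) (proj₂ (value-range (shift-<n kp<n))))

    small-late : ∀ {u} → suc u < value p → k ≤ position (suc u)
    small-late u<t = ≮⇒≥ λ pos<k → <⇒≱ u<t (subst (value p ≤_) (proj₂ (small u<t)) (prefix pos<k))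

    one-at-end : ¬ (k + position 1 < n)
    one-at-end = minimum-not-interior (proj₂ (small 2≤t)) (small-late 2≤t)

    moved : ℕ → ℕ
    moved zero    = position 1
    moved (suc u) = position (suc u) ∸ k

    moved-<n : ∀ {i} → i < value p → moved i < n
    moved-<n {zero}  _   = proj₁ (small 2≤t)
    moved-<n {suc u} u<t = ≤-<-trans (m∸n≤m _ k) (proj₁ (small u<t))

    moved-below : ∀ {i} → i < value p → value (moved i) < value p
    moved-below {zero}  _   = subst (_< value p) (sym (proj₂ (small 2≤t))) 2≤t
    moved-below {suc u} u<t = shift-back-below kp<n rise (small-late u<t) (proj₁ (small u<t))
                                (subst (_≤ value p) (sym (proj₂ (small u<t))) (<⇒≤ u<t))

    moved-back : ∀ {u} → suc u < value p → moved (suc u) ≡ position 1 → ⊥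
    moved-back u<t eq = one-at-end
      (subst (_< n) (trans (sym (m+[n∸m]≡n (small-late u<t))) (cong (k +_) eq)) (proj₁ (small u<t)))

    moved-injective : InjectiveOn (value p) moved
    moved-injective {zero}  {zero}  _   _   _  = refl
    moved-injective {zero}  {suc w} _   w<t eq = ⊥-elim (moved-back w<t (sym eq))
    moved-injective {suc u} {zero}  u<t _   eq = ⊥-elim (moved-back u<t eq)
    moved-injective {suc u} {suc w} u<t w<t eq = begin
      suc u                       ≡⟨ proj₂ (small u<t) ⟨
      value (position (suc u))    ≡⟨ cong value (∸-cancelʳ-≡ (small-late u<t) (small-late w<t) eq) ⟩
      value (position (suc w))    ≡⟨ proj₂ (small w<t) ⟩
      suc w                       ∎
      where open ≡-Reasoning

    impossible : ⊥
    impossible = few-values-below (<⇒≤ 2≤t) moved moved-<n moved-below moved-injective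

  fall-at : ∀ {p} → 2 ≤ value p → k + p < n → PrefixAtLeast P k (value p) → value (k + p) < value p
  fall-at {p} 2≤t kp<n prefix with <-cmp (value (k + p)) (value p)
  ... | tri< fall _ _ = fall
  ... | tri≈ _ eq _   = contradiction (value-injective kp<n (shift-<n kp<n) eq) (shifted-≢ p)
  ... | tri> _ _ rise = ⊥-elim (Rise.impossible 2≤t kp<n prefix rise)

  progression-start : ∀ {r p} → 1 ≤ r → r * k + p < n → k + p < n
  progression-start {suc r} {p} _ = ≤-<-trans (+-monoˡ-≤ p (m≤m+n k (r * k)))

  ¬trapped : ¬ Trapped P k
  ¬trapped (p , _ , refl , bound , late-or-big , prefix) = [ late-start , descend ] late-or-big
    where
    p<n = ≤-<-trans (m≤n+m p (value p * k)) bound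
    kp<n = progression-start (proj₁ (value-range p<n)) bound
    descend : 2 ≤ value p → ⊥
    descend 2≤r = descent bound (fall-at 2≤r kp<n prefix)
    late-start : k ≤ p → ⊥
    late-start k≤p with value p ≟ 1
    ... | yes p↦1 = minimum-not-interior p↦1 k≤p kp<n
    ... | no  p↦≢1 = descend (≤∧≢⇒< (proj₁ (value-range p<n)) (≢-sym p↦≢1))

module Conditions {n k a} (a↭ : IsPerm n a) (1≤k : 1 ≤ k) (k≤n : k ≤ n) where

  P : Perm n
  P = fromList a↭

  open Perm P

  in-prefix : ∀ {x} → x < k → entry a x ∈ take k a
  in-prefix x<k = entry-∈-take a x<k (subst (_ <_) (sym (IsPerm-length a↭)) (<-≤-trans x<k k≤n))

  prefix-range : ∀ {x} → x < k → 1 ≤ entry a x × entry a x ≤ n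
  prefix-range x<k = value-range (<-≤-trans x<k k≤n)

  prefixAtLeast-low : ∀ {r} → (∀ j → 1 ≤ j → j < r → ¬ j ∈ take k a) → PrefixAtLeast P k r
  prefixAtLeast-low avoid x<k = ≮⇒≥ λ x↦<r → avoid _ (proj₁ (prefix-range x<k)) x↦<r (in-prefix x<k)

  prefixAtLeast-high : ∀ {r} → (∀ j → n + 2 ≤ j + r → j ≤ n → ¬ j ∈ take k a) → PrefixAtLeast (complement P) k r
  prefixAtLeast-high {r} avoid {x} x<k =
    m+n≤o⇒m≤o∸n r (subst (_≤ suc n) (+-comm (entry a x) r) (≤-pred (subst (entry a x + r <_) (+-comm n 2) below)))
    where
    below : entry a x + r < n + 2
    below = ≰⇒> λ big → avoid _ big (proj₂ (prefix-range x<k)) (in-prefix x<k)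

  1+n∸[n+1∸r]≡r : ∀ {r} → r ≤ suc n → suc n ∸ (n + 1 ∸ r) ≡ r
  1+n∸[n+1∸r]≡r {r} r≤1+n = trans (cong (λ m → suc n ∸ (m ∸ r)) (+-comm n 1)) (m∸[m∸n]≡n r≤1+n)

  t*k+1≤n⇒t≤n : ∀ {t} → t * k + 1 ≤ n → t ≤ n
  t*k+1≤n⇒t≤n {t} b = ≤-trans (m≤m*n t k {{>-nonZero 1≤k}}) (≤-trans (m≤m+n (t * k) 1) b)

  condA⇒trapped : CondA n k a → Trapped (complement P) k
  condA⇒trapped (suc (suc s) , s≤s (s≤s z≤n) , bound , v∈ , avoid)
    with p , k≤p , p< , p↦v ← ∈-slice⇒entry a v∈ =
    p , suc s , complement-value , m<n∸o⇒o+m<n p< , inj₁ k≤p ,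
    prefixAtLeast-high λ j big → avoid j (subst₂ _≤_ (sym (+-suc n 2)) (sym (+-suc j (suc s))) (s≤s big))
    where
    complement-value : suc n ∸ entry a p ≡ suc s
    complement-value = trans (cong (suc n ∸_) (trans p↦v (cong (_∸ suc (suc s)) (+-suc n 1))))
                             (1+n∸[n+1∸r]≡r (≤-trans (n≤1+n (suc s)) (m≤n⇒m≤1+n (t*k+1≤n⇒t≤n bound))))

  condB⇒trapped : CondB n k a → Trapped P k
  condB⇒trapped (suc (suc s) , s≤s (s≤s z≤n) , _ , r∈ , avoid)
    with p , k≤p , p< , p↦r ← ∈-slice⇒entry a r∈ =
    p , suc s , p↦r , m<n∸o⇒o+m<n p< , inj₁ k≤p ,
    prefixAtLeast-low λ j 1≤j j<r → avoid j 1≤j (subst (_≤ suc (suc s)) (+-comm 2 j) (s≤s j<r))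

  condC⇒trapped : CondC n k a → Trapped (complement P) k
  condC⇒trapped (t , 2≤t , bound , v∈ , avoid)
    with p , _ , p< , p↦v ← ∈-slice⇒entry {i = 0} a v∈ =
    p , t , trans (cong (suc n ∸_) p↦v) (1+n∸[n+1∸r]≡r (m≤n⇒m≤1+n (t*k+1≤n⇒t≤n bound))) ,
    m<n∸o⇒o+m<n (<-≤-trans p< (m⊓n≤n k _)) , inj₂ 2≤t , prefixAtLeast-high avoid

  condD⇒trapped : CondD n k a → Trapped P k
  condD⇒trapped (t , 2≤t , _ , t∈ , avoid)
    with p , _ , p< , p↦t ← ∈-slice⇒entry {i = 0} a t∈ =
    p , t , p↦t , m<n∸o⇒o+m<n (<-≤-trans p< (m⊓n≤n k _)) , inj₂ 2≤t , prefixAtLeast-low avoid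

lemma3p15 : (n k : ℕ) → 2 ≤ k → k + 1 ≤ n → (a : List ℕ) → IsPerm n a →
    CondA n k a ⊎ CondB n k a ⊎ CondC n k a ⊎ CondD n k a →
    ¬ OnClosedWalk n k a
lemma3p15 n k 2≤k k+1≤n a a↭ cond (v , walk , i , i<k , vi≡a) =
  [ ¬trappedᶜ ∘ condA⇒trapped , [ ¬trapped ∘ condB⇒trapped ,
  [ ¬trappedᶜ ∘ condC⇒trapped , ¬trapped ∘ condD⇒trapped ] ] ] cond
  where
  1≤k = ≤-trans (s≤s z≤n) 2≤k
  open Conditions a↭ 1≤k (≤-trans (m≤m+n k 1) k+1≤n)
  shift : ShiftOrder n k (entry a) (entry a)
  shift = subst (λ l → ShiftOrder n k (entry l) (entry l)) vi≡a (closedWalk⇒shiftOrder walk i<k)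
  open ShiftInvariant P 1≤k shift using (¬trapped)
  open ShiftInvariant (complement P) 1≤k (complement-shiftOrder P shift) using () renaming (¬trapped to ¬trappedᶜ)
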